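{- Let $em:Q\hookrightarrow B^n$ be a simplistic sculpture, with $Q$ connected. Then $\mathsf{ST}(em)\cong \mathsf{H}(Q)/\!\equiv_{em}$ as ST-structures.
   Context: Precubical sets: families of disjoint sets $Q_n$ with face maps $s_k,t_k:Q_n\to Q_{n-1}$ ($k=1,\dots,n$) satisfying $\alpha_k\beta_\ell=\beta_{\ell-1}\alpha_k$ for $\alpha,\beta\in\{s,t\}$, $k<\ell$. An HDA is a finite precubical set with initial cell $I\in Q_0$; HDA morphisms commute with face maps and preserve initial cells; embeddings are injective ones. A step is $q'\xrightarrow{s_i}q$ with $s_iq=q'$ or $q\xrightarrow{t_i}q'$ with $t_iq=q'$; rooted paths are sequences of consecutive steps starting at $I$; $Q$ is connected if every cell is the end of a rooted path. The bulk $B^n$ has $k$-cells the tuples in $\{0,\ast,1\}^n$ with exactly $k$ entries $\ast$; $s_j$ (resp. $t_j$) replaces the $j$-th $\ast$ by $0$ (resp. $1$); initial cell $(0,\dots,0)$. A sculpture is an HDA embedding $em:Q\hookrightarrow B^n$; it is simplistic if there is no HDA embedding of $Q$ into $B^{n'}$ for any $n'<n$. Universal labels: $\approx$ is the equivalence on $Q_1$ generated by $(s_iq,t_iq)$, $q\in Q_2$, $i\in\{1,2\}$; $\mathcal U(Q)=Q_1/\approx$, $\lambda(e)$ the class of $e$; $\lambda_i(q)=\lambda(s_1\cdots s_{i-1}s_{i+1}\cdots s_m(q))$ for $q\in Q_m$. For a rooted path $\pi$ define $(S_\pi,T_\pi)\subseteq\mathcal U(Q)$: trivial path at $I$ gives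 $(\emptyset,\emptyset)$; $\pi=\pi'\xrightarrow{s_i}q$ gives $S_\pi=S_{\pi'}\cup\{\lambda_i(q)\}$, $T_\pi=T_{\pi'}$; $\pi=\pi'\xrightarrow{t_i}t_i(q')$ with $q'$ the end of $\pi'$ gives $S_\pi=S_{\pi'}$, $T_\pi=T_{\pi'}\cup\{\lambda_i(q')\}$. An ST-structure is a pair $(E,\Sigma)$ with $E$ finite and $\Sigma$ a set of pairs $(S,T)$, $T\subseteq S\subseteq E$; a morphism is a partial function $f:E\rightharpoonup E'$, total and injective on each $S$ with $(S,T)\in\Sigma$, and with $(f(S),f(T))\in\Sigma'$; an isomorphism is a bijective morphism. $\mathsf H(Q)$ is the ST-structure $(\mathcal U(Q),\{(S_\pi,T_\pi):\pi\text{ rooted path}\})$. For an equivalence $\sim$ on events, the quotient ST-structure is $(E/\!\sim,\{(S/\!\sim,T/\!\sim)\})$, where $A/\!\sim$ is the set of classes of elements of $A$. The map $\mathcal U(em):\mathcal U(Q)\to\{1,\dots,n\}$ sends $\lambda(e)$ to the unique index $k$ with $em(e)_k=\ast$ (well defined); $\equiv_{em}$ is the equivalence $a\equiv_{em}b$ iff $\mathcal U(em)(a)=\mathcal U(em)(b)$. $\mathsf{ST}(em)$ is the ST-structure on events $\{1,\dots,n\}$ with configurations $(\{i:em(q)_i\ne0\},\{i:em(q)_i=1\})$ for $q\in Q$. -}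

module Defs where

open import Data.Nat using (ℕ; zero; suc; _≤_; _<_; _≟_)
open import Data.Fin using (Fin; zero; suc; toℕ; inject₁; fromℕ; lower₁)
open import Data.Vec using (Vec; []; _∷_; lookup; replicate)
open import Data.Product using (Σ; ∃; _×_; _,_)
open import Data.Sum using (_⊎_)
open import Data.Empty using (⊥)
open import Level using (Lift)
open import Function.Bundles using (_↔_; _⇔_)
open import Relation.Nullary using (¬_; yes; no)
open import Relation.Binary.PropositionalEquality using (_≡_; _≢_)
open import Relation.Binary.Structures using (IsEquivalence)
open import Relation.Binary.Construct.Closure.Equivalence using (EqClosure)
import Relation.Binary.Construct.Closure.Equivalence as EqC

-- Precubical sets and HDAs
-- Face maps are indexed 0-based: index  k : Fin (suc n)  on  Q (suc n)
-- corresponds to the paper's face map with index  k+1 .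

data Dir : Set where
  src tgt : Dir

record Precubical : Set₁ where
  field
    Cell : ℕ → Set
    face : Dir → ∀ {n} → Fin (suc n) → Cell (suc n) → Cell n
    -- α_k β_ℓ = β_{ℓ-1} α_k  for k < ℓ   (here ℓ = suc ℓ', so k < ℓ iff k ≤ ℓ')
    cubical : ∀ {n} (α β : Dir) (k ℓ' : Fin (suc n)) (q : Cell (suc (suc n))) →
              toℕ k ≤ toℕ ℓ' →
              face α k (face β (suc ℓ') q) ≡ face β ℓ' (face α (inject₁ k) q)

record HDA : Set₁ where
  field
    pre  : Precubical
  open Precubical pre public
  field
    card      : ℕ → ℕ
    enum      : ∀ m → Cell m ↔ Fin (card m)
    dimBound  : ∃ λ N → ∀ m → N ≤ m → card m ≡ 0
    init      : Cell 0

-- The bulk B^n, given by its cells: vectors over {0,∗,1}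

data Tri : Set where
  O S I : Tri      -- O = 0, S = ∗, I = 1

countStar : ∀ {n} → Vec Tri n → ℕ
countStar [] = 0
countStar (O ∷ v) = countStar v
countStar (S ∷ v) = suc (countStar v)
countStar (I ∷ v) = countStar v

replaceStar : ∀ {n} → Tri → ℕ → Vec Tri n → Vec Tri n
replaceStar b j [] = []
replaceStar b j (O ∷ v) = O ∷ replaceStar b j v
replaceStar b zero (S ∷ v) = b ∷ v
replaceStar b (suc j) (S ∷ v) = S ∷ replaceStar b j v
replaceStar b j (I ∷ v) = I ∷ replaceStar b j v

dirVal : Dir → Tri
dirVal src = O
dirVal tgt = I

-- position (0-based) of the first ∗ (n if there is none)
starIndex : ∀ {n} → Vec Tri n → ℕ
starIndex [] = 0
starIndex (S ∷ v) = 0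
starIndex (O ∷ v) = suc (starIndex v)
starIndex (I ∷ v) = suc (starIndex v)

record Embedding (Q : HDA) (n : ℕ) : Set where
  open HDA Q
  field
    em        : ∀ {m} → Cell m → Vec Tri n
    dimOK     : ∀ {m} (q : Cell m) → countStar (em q) ≡ m
    faceOK    : ∀ {m} (α : Dir) (i : Fin (suc m)) (q : Cell (suc m)) →
                em (face α i q) ≡ replaceStar (dirVal α) (toℕ i) (em q)
    initOK    : em init ≡ replicate n O
    injective : ∀ {m} (q q' : Cell m) → em q ≡ em q' → q ≡ q'

Simplistic : {Q : HDA} {n : ℕ} → Embedding Q n → Set
Simplistic {Q} {n} _ = ¬ (Σ ℕ λ n' → n' < n × Embedding Q n')

-- ST-structures (events form a setoid, so that quotients are possible;
-- subsets are predicates on events)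

Pred : Set → Set₁
Pred E = E → Set

_≐_ : {E : Set} → Pred E → Pred E → Set
A ≐ B = ∀ x → A x ⇔ B x

record STStructure : Set₂ where
  field
    Ev      : Set
    _≈_     : Ev → Ev → Set
    isEquiv : IsEquivalence _≈_
    Conf    : Pred Ev → Pred Ev → Set₁

image : (X Y : STStructure) → (STStructure.Ev X → STStructure.Ev Y) →
        Pred (STStructure.Ev X) → Pred (STStructure.Ev Y)
image X Y f A y = ∃ λ x → A x × STStructure._≈_ Y (f x) y

-- an isomorphism of ST-structures: a bijective morphism
-- (a bijective partial function is total, hence total & injective on every S)
record IsIso (X Y : STStructure) (f : STStructure.Ev X → STStructure.Ev Y) : Set₁ where
  open STStructure X renaming (Ev to E₁; _≈_ to _≈₁_; Conf to Conf₁)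
  open STStructure Y renaming (Ev to E₂; _≈_ to _≈₂_; Conf to Conf₂)
  field
    wellDef    : ∀ {x y} → x ≈₁ y → f x ≈₂ f y
    injective  : ∀ {x y} → f x ≈₂ f y → x ≈₁ y
    surjective : ∀ y → ∃ λ x → f x ≈₂ y
    preserves  : ∀ S T → Conf₁ S T → Conf₂ (image X Y f S) (image X Y f T)

_≅_ : STStructure → STStructure → Set₁
X ≅ Y = Σ (STStructure.Ev X → STStructure.Ev Y) (IsIso X Y)

quotientST : (X : STStructure) (_∼_ : STStructure.Ev X → STStructure.Ev X → Set) →
             IsEquivalence _∼_ → STStructure
quotientST X _∼_ eq = record
  { Ev = Ev
  ; _≈_ = _∼_
  ; isEquiv = eq
  ; Conf = λ S' T' → ∃ λ S → ∃ λ T → Conf S T × (S' ≐ sat S) × (T' ≐ sat T)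
  }
  where
  open STStructure X
  sat : Pred Ev → Pred Ev       -- A/∼ : classes of elements of A
  sat A x = ∃ λ y → A y × (y ∼ x)

module _ (Q : HDA) where
  open HDA Q

  GenU : Cell 1 → Cell 1 → Set
  GenU e e' = ∃ λ (q : Cell 2) → ∃ λ (i : Fin 2) →
              (e ≡ face src i q) × (e' ≡ face tgt i q)

  -- ≈ on Q_1; U(Q) = Q_1/≈ is the setoid (Cell 1, _≈U_), λ(e) = e
  _≈U_ : Cell 1 → Cell 1 → Set
  _≈U_ = EqClosure GenU

  lastOnly : (k : ℕ) → Cell (suc k) → Cell 1
  lastOnly zero q = q
  lastOnly (suc k) q = lastOnly k (face src (inject₁ (fromℕ k)) q)

  -- λ_i(q) = λ(s_1 ⋯ s_{i-1} s_{i+1} ⋯ s_m (q)),  q ∈ Q_{m}, m = suc k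
  lam : (k : ℕ) → Fin (suc k) → Cell (suc k) → Cell 1
  lam zero i q = q
  lam (suc k) i q with suc k ≟ toℕ i
  ... | yes _ = lastOnly (suc k) q
  ... | no ne = lam k (lower₁ i ne) (face src (fromℕ (suc k)) q)

  data Path : (m : ℕ) → Cell m → Set where
    start : Path 0 init
    up    : ∀ {m q'} → Path m q' → (i : Fin (suc m)) (q : Cell (suc m)) →
            face src i q ≡ q' → Path (suc m) q
    down  : ∀ {m q} → Path (suc m) q → (i : Fin (suc m)) → Path m (face tgt i q)

  Connected : Set
  Connected = ∀ m (q : Cell m) → Path m q

  Sπ : ∀ {m q} → Path m q → Pred (Cell 1)
  Sπ start x = ⊥
  Sπ (up {m} π i q _) x = Sπ π x ⊎ (x ≈U lam m i q)
  Sπ (down π i) x = Sπ π x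

  Tπ : ∀ {m q} → Path m q → Pred (Cell 1)
  Tπ start x = ⊥
  Tπ (up π i q _) x = Tπ π x
  Tπ (down {m} {q} π i) x = Tπ π x ⊎ (x ≈U lam m i q)

  H : STStructure
  H = record
    { Ev = Cell 1
    ; _≈_ = _≈U_
    ; isEquiv = EqC.isEquivalence GenU
    ; Conf = λ S T → Lift _ (∃ λ m → ∃ λ (q : Cell m) → ∃ λ (π : Path m q) →
               (S ≐ Sπ π) × (T ≐ Tπ π))
    }

module _ {Q : HDA} {n : ℕ} (E : Embedding Q n) where
  open HDA Q
  open Embedding E

  -- U(em)(λ(e)) = the index of the unique ∗ in em(e)
  Uem : Cell 1 → ℕ
  Uem e = starIndex (em e)

  _≡em_ : Cell 1 → Cell 1 → Set
  a ≡em b = Uem a ≡ Uem b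

  ≡em-isEquiv : IsEquivalence _≡em_
  ≡em-isEquiv = record
    { refl = Relation.Binary.PropositionalEquality.refl
    ; sym = Relation.Binary.PropositionalEquality.sym
    ; trans = Relation.Binary.PropositionalEquality.trans }
    where import Relation.Binary.PropositionalEquality

  H/≡em : STStructure
  H/≡em = quotientST (H Q) _≡em_ ≡em-isEquiv

  STem : STStructure
  STem = record
    { Ev = Fin n
    ; _≈_ = _≡_
    ; isEquiv = Relation.Binary.PropositionalEquality.isEquivalence
    ; Conf = λ S T → Lift _ (∃ λ m → ∃ λ (q : Cell m) →
               (S ≐ λ i → lookup (em q) i ≢ O) × (T ≐ λ i → lookup (em q) i ≡ I))
    }
    where import Relation.Binary.PropositionalEquality

module Submission where

-- Label every edge e of Q by the coordinate U(e) of the unique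
-- ∗ in em(e).  Two facts about an arbitrary embedding em : Q ↪ Bⁿ:
--   * U is invariant under ≈ (opposite edges of a square carry the same ∗),
--     and U(λ_i(q)) is the position of the i-th ∗ of em(q);
--   * for every rooted path π ending in q, the labels of S_π are exactly the
--     coordinates where em(q) is not 0, and the labels of T_π those where it
--     is 1.  (Each step changes only the coordinate of the ∗ it consumes or
--     creates, and the label of that ∗ enters S_π resp. T_π.)
-- If em is simplistic, every coordinate c is the label of some edge:
-- otherwise, by the second fact and connectedness, coordinate c is 0 in all
-- of em(Q), and deleting it embeds Q into B^(n-1).  Sending c to an edge
-- labelled c is then a bijection {1..n} → U(Q)/≡em, and the second fact
-- shows it maps the configuration of each cell q onto (S_π/≡em, T_π/≡em).

open import Data.Nat using (ℕ; zero; suc; pred; _≤_; _<_; z≤n; s≤s; _≟_)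
open import Data.Nat.Properties using (≤-refl; ≤∧≢⇒<; n<1+n)
open import Data.Fin using (Fin; zero; suc; toℕ; inject₁; fromℕ; lower₁; opposite)
open import Data.Fin.Properties
  using (toℕ-injective; toℕ-inject₁; toℕ-fromℕ; toℕ-lower₁; any?; toℕ<n)
open import Data.Vec using (Vec; []; _∷_; lookup; replicate)
open import Data.Vec.Properties using (∷-injectiveˡ; ∷-injectiveʳ)
open import Data.Product using (Σ; ∃; _×_; _,_; proj₁; proj₂)
open import Data.Sum using (_⊎_; inj₁; inj₂; [_,_])
open import Data.Sum.Function.Propositional using (_⊎-⇔_)
open import Data.Empty using (⊥-elim)
open import Level using (lift)
open import Function using (id; _∘_; case_of_)
open import Function.Bundles using (_⇔_; mk⇔; Equivalence; Inverse)
open import Function.Properties.Equivalence using () renaming (trans to ⇔-trans)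
open import Function.Construct.Identity using (⇔-id)
open import Function.Construct.Symmetry using (⇔-sym)
open import Relation.Nullary using (¬_; Dec; yes; no)
open import Relation.Nullary.Decidable using (decidable-stable; map′)
open import Relation.Binary.PropositionalEquality hiding ([_])
open import Relation.Binary.Construct.Closure.Equivalence using (gfold)
open import Relation.Binary.Construct.Closure.ReflexiveTransitive using (ε)
open import Defs

-- Coordinate k of a bulk cell, indexed by a natural number (0 out of range),
-- since edge labels are natural numbers.
at : ∀ {n} → Vec Tri n → ℕ → Tri
at []      k       = O
at (x ∷ v) zero    = x
at (x ∷ v) (suc k) = at v k

at-lookup : ∀ {n} (v : Vec Tri n) (i : Fin n) → at v (toℕ i) ≡ lookup v i
at-lookup (x ∷ v) zero    = refl
at-lookup (x ∷ v) (suc i) = at-lookup v i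

at-replicate : ∀ n k → at (replicate n O) k ≡ O
at-replicate zero    k       = refl
at-replicate (suc n) zero    = refl
at-replicate (suc n) (suc k) = at-replicate n k

at-in-range : ∀ {n} (v : Vec Tri n) k → at v k ≢ O → Σ (Fin n) λ i → toℕ i ≡ k
at-in-range []      k       ne = ⊥-elim (ne refl)
at-in-range (x ∷ v) zero    ne = zero , refl
at-in-range (x ∷ v) (suc k) ne with at-in-range v k ne
... | i , e = suc i , cong suc e

isO? : (x : Tri) → Dec (x ≡ O)
isO? O = yes refl
isO? S = no λ ()
isO? I = no λ ()

pos : ∀ {n} → ℕ → Vec Tri n → ℕ
pos j       []      = 0
pos j       (O ∷ v) = suc (pos j v)
pos j       (I ∷ v) = suc (pos j v)
pos zero    (S ∷ v) = 0
pos (suc j) (S ∷ v) = suc (pos j v)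

starIndex≡pos0 : ∀ {n} (v : Vec Tri n) → starIndex v ≡ pos 0 v
starIndex≡pos0 []      = refl
starIndex≡pos0 (O ∷ v) = cong suc (starIndex≡pos0 v)
starIndex≡pos0 (S ∷ v) = refl
starIndex≡pos0 (I ∷ v) = cong suc (starIndex≡pos0 v)

pos-before : ∀ {n} b j j' (v : Vec Tri n) → j' < j → pos j' (replaceStar b j v) ≡ pos j' v
pos-before b j       j'       []      p       = refl
pos-before b j       j'       (O ∷ v) p       = cong suc (pos-before b j j' v p)
pos-before b j       j'       (I ∷ v) p       = cong suc (pos-before b j j' v p)
pos-before b (suc j) zero     (S ∷ v) p       = refl
pos-before b (suc j) (suc j') (S ∷ v) (s≤s p) = cong suc (pos-before b j j' v p)

pos-after : ∀ {n} α j j' (v : Vec Tri n) → j ≤ j' →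
            pos j' (replaceStar (dirVal α) j v) ≡ pos (suc j') v
pos-after α   j       j'       []      p       = refl
pos-after α   j       j'       (O ∷ v) p       = cong suc (pos-after α j j' v p)
pos-after α   j       j'       (I ∷ v) p       = cong suc (pos-after α j j' v p)
pos-after src zero    j'       (S ∷ v) p       = refl
pos-after tgt zero    j'       (S ∷ v) p       = refl
pos-after α   (suc j) (suc j') (S ∷ v) (s≤s p) = cong suc (pos-after α j j' v p)

data StepAt (b : Tri) (p k : ℕ) : Tri → Tri → Set where
  changed   : p ≡ k → StepAt b p k S b
  unchanged : ∀ {x} → p ≢ k → StepAt b p k x x

step-suc : ∀ {b p k x x'} → StepAt b p k x x' → StepAt b (suc p) (suc k) x x'
step-suc (changed e)    = changed (cong suc e)
step-suc (unchanged ne) = unchanged (ne ∘ cong pred)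

replaceStar-step : ∀ {n} b j (v : Vec Tri n) → j < countStar v → ∀ k →
                   StepAt b (pos j v) k (at v k) (at (replaceStar b j v) k)
replaceStar-step b j       (O ∷ v) lt       zero    = unchanged λ ()
replaceStar-step b j       (O ∷ v) lt       (suc k) = step-suc (replaceStar-step b j v lt k)
replaceStar-step b j       (I ∷ v) lt       zero    = unchanged λ ()
replaceStar-step b j       (I ∷ v) lt       (suc k) = step-suc (replaceStar-step b j v lt k)
replaceStar-step b zero    (S ∷ v) lt       zero    = changed refl
replaceStar-step b zero    (S ∷ v) lt       (suc k) = unchanged λ ()
replaceStar-step b (suc j) (S ∷ v) lt       zero    = unchanged λ ()
replaceStar-step b (suc j) (S ∷ v) (s≤s lt) (suc k) = step-suc (replaceStar-step b j v lt k)

step-hit : ∀ {b p x x'} → StepAt b p p x x' → x ≡ S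
step-hit (changed _)    = refl
step-hit (unchanged ne) = ⊥-elim (ne refl)

-- Going up from a lower face s_i q to q, the
-- ∗ at p was 0 before; going down from q to an upper face t_i q, it becomes 1.
lowering-support : ∀ {p k x x'} → StepAt O p k x x' → (x' ≢ O ⊎ p ≡ k) ⇔ (x ≢ O)
lowering-support (changed e)    = mk⇔ (λ _ ()) (λ _ → inj₂ e)
lowering-support (unchanged ne) = mk⇔ [ id , ⊥-elim ∘ ne ] inj₁

lowering-top : ∀ {p k x x'} → StepAt O p k x x' → (x' ≡ I) ⇔ (x ≡ I)
lowering-top (changed _)    = mk⇔ (λ ()) (λ ())
lowering-top (unchanged _)  = ⇔-id _

raising-support : ∀ {p k x x'} → StepAt I p k x x' → (x ≢ O) ⇔ (x' ≢ O)
raising-support (changed _)    = mk⇔ (λ _ ()) (λ _ ())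
raising-support (unchanged _)  = ⇔-id _

raising-top : ∀ {p k x x'} → StepAt I p k x x' → (x ≡ I ⊎ p ≡ k) ⇔ (x' ≡ I)
raising-top (changed e)    = mk⇔ (λ _ → refl) (λ _ → inj₂ e)
raising-top (unchanged ne) = mk⇔ [ id , ⊥-elim ∘ ne ] inj₁

fin-support : ∀ {n} (P : Tri → Set) → (∀ {x} → P x → x ≢ O) → (v : Vec Tri n) (k : ℕ) →
              (∃ λ i → P (lookup v i) × toℕ i ≡ k) ⇔ P (at v k)
fin-support P P⇒≢O v k = mk⇔ to from
  where
  to : (∃ λ i → P (lookup v i) × toℕ i ≡ k) → P (at v k)
  to (i , p , refl) = subst P (sym (at-lookup v i)) p
  from : P (at v k) → ∃ λ i → P (lookup v i) × toℕ i ≡ k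
  from p with at-in-range v k (P⇒≢O p)
  ... | i , refl = i , subst P (at-lookup v i) p , refl

delete : ∀ {n} → Fin (suc n) → Vec Tri (suc n) → Vec Tri n
delete         zero    (x ∷ v) = v
delete {suc n} (suc c) (x ∷ v) = x ∷ delete c v

countStar-delete : ∀ {n} c (v : Vec Tri (suc n)) → lookup v c ≡ O →
                   countStar (delete c v) ≡ countStar v
countStar-delete         zero    (O ∷ v) refl = refl
countStar-delete {suc n} (suc c) (O ∷ v) e = countStar-delete c v e
countStar-delete {suc n} (suc c) (S ∷ v) e = cong suc (countStar-delete c v e)
countStar-delete {suc n} (suc c) (I ∷ v) e = countStar-delete c v e

delete-replaceStar : ∀ {n} b j c (v : Vec Tri (suc n)) → lookup v c ≡ O →
                     delete c (replaceStar b j v) ≡ replaceStar b j (delete c v)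
delete-replaceStar         b j       zero    (O ∷ v) refl = refl
delete-replaceStar {suc n} b j       (suc c) (O ∷ v) e = cong (O ∷_) (delete-replaceStar b j c v e)
delete-replaceStar {suc n} b j       (suc c) (I ∷ v) e = cong (I ∷_) (delete-replaceStar b j c v e)
delete-replaceStar {suc n} b zero    (suc c) (S ∷ v) e = refl
delete-replaceStar {suc n} b (suc j) (suc c) (S ∷ v) e = cong (S ∷_) (delete-replaceStar b j c v e)

delete-replicate : ∀ n c → delete c (replicate (suc n) O) ≡ replicate n O
delete-replicate n       zero    = refl
delete-replicate (suc n) (suc c) = cong (O ∷_) (delete-replicate n c)

delete-injective : ∀ {n} c (v w : Vec Tri (suc n)) → lookup v c ≡ O → lookup w c ≡ O →
                   delete c v ≡ delete c w → v ≡ w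
delete-injective         zero    (O ∷ v) (O ∷ w) refl refl e = cong (O ∷_) e
delete-injective {suc n} (suc c) (x ∷ v) (y ∷ w) p q e =
  cong₂ _∷_ (∷-injectiveˡ e) (delete-injective c v w p q (∷-injectiveʳ e))

shrink : ∀ {Q n} (E : Embedding Q (suc n)) (c : Fin (suc n)) →
         (∀ {m} (q : HDA.Cell Q m) → lookup (Embedding.em E q) c ≡ O) → Embedding Q n
shrink {Q} {n} E c zero-at-c = record
  { em        = λ q → delete c (em q)
  ; dimOK     = λ q → trans (countStar-delete c _ (zero-at-c q)) (dimOK q)
  ; faceOK    = λ α i q → trans (cong (delete c) (faceOK α i q))
                                (delete-replaceStar _ _ c (em q) (zero-at-c q))
  ; initOK    = trans (cong (delete c) initOK) (delete-replicate n c)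
  ; injective = λ q q' e → injective q q' (delete-injective c _ _ (zero-at-c q) (zero-at-c q') e)
  }
  where open Embedding E

simplistic-uses-every-coordinate :
  ∀ {Q n} (E : Embedding Q n) → Simplistic E → (c : Fin n) →
  ¬ (∀ {m} (q : HDA.Cell Q m) → lookup (Embedding.em E q) c ≡ O)
simplistic-uses-every-coordinate {n = suc n} E simplistic c zero-at-c =
  simplistic (n , n<1+n n , shrink E c zero-at-c)

module Labelling {Q : HDA} {n : ℕ} (E : Embedding Q n) where
  open HDA Q
  open Embedding E

  U : Cell 1 → ℕ
  U = Uem E

  star-in-range : ∀ {m} (i : Fin (suc m)) (q : Cell (suc m)) → toℕ i < countStar (em q)
  star-in-range i q = subst (toℕ i <_) (sym (dimOK q)) (toℕ<n i)

  U-square-face : ∀ α (i : Fin 2) (q : Cell 2) →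
                  U (face α i q) ≡ pos (toℕ (opposite i)) (em q)
  U-square-face α zero q = begin
    starIndex (em (face α zero q))                     ≡⟨ cong starIndex (faceOK α zero q) ⟩
    starIndex (replaceStar (dirVal α) 0 (em q))       ≡⟨ starIndex≡pos0 _ ⟩
    pos 0 (replaceStar (dirVal α) 0 (em q))           ≡⟨ pos-after α 0 0 (em q) z≤n ⟩
    pos 1 (em q)                                       ∎
    where open ≡-Reasoning
  U-square-face α (suc zero) q = begin
    starIndex (em (face α (suc zero) q))               ≡⟨ cong starIndex (faceOK α (suc zero) q) ⟩
    starIndex (replaceStar (dirVal α) 1 (em q))       ≡⟨ starIndex≡pos0 _ ⟩
    pos 0 (replaceStar (dirVal α) 1 (em q))           ≡⟨ pos-before (dirVal α) 1 0 (em q) (s≤s z≤n) ⟩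
    pos 0 (em q)                                       ∎
    where open ≡-Reasoning

  U-respects-≈ : ∀ {x y} → _≈U_ Q x y → U x ≡ U y
  U-respects-≈ = gfold isEquivalence U λ { (q , i , refl , refl) →
    trans (U-square-face src i q) (sym (U-square-face tgt i q)) }

  -- lastOnly k q fills all ∗s of q but the last one with 0.
  U-lastOnly : ∀ k (q : Cell (suc k)) → U (lastOnly Q k q) ≡ pos k (em q)
  U-lastOnly zero    q = starIndex≡pos0 (em q)
  U-lastOnly (suc k) q = begin
    U (lastOnly Q k (face src (inject₁ (fromℕ k)) q))   ≡⟨ U-lastOnly k _ ⟩
    pos k (em (face src (inject₁ (fromℕ k)) q))         ≡⟨ cong (pos k) (faceOK src _ q) ⟩
    pos k (replaceStar O (toℕ (inject₁ (fromℕ k))) (em q))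
      ≡⟨ cong (λ j → pos k (replaceStar O j (em q))) (trans (toℕ-inject₁ (fromℕ k)) (toℕ-fromℕ k)) ⟩
    pos k (replaceStar O k (em q))                       ≡⟨ pos-after src k k (em q) ≤-refl ⟩
    pos (suc k) (em q)                                   ∎
    where open ≡-Reasoning

  U-lam : ∀ k (i : Fin (suc k)) (q : Cell (suc k)) → U (lam Q k i q) ≡ pos (toℕ i) (em q)
  U-lam zero    zero q = starIndex≡pos0 (em q)
  U-lam (suc k) i    q with suc k ≟ toℕ i
  ... | yes e  = trans (U-lastOnly (suc k) q) (cong (λ j → pos j (em q)) e)
  ... | no  ne = begin
    U (lam Q k (lower₁ i ne) (face src (fromℕ (suc k)) q))   ≡⟨ U-lam k (lower₁ i ne) _ ⟩
    pos (toℕ (lower₁ i ne)) (em (face src (fromℕ (suc k)) q)) ≡⟨ cong (pos _) (faceOK src (fromℕ (suc k)) q) ⟩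
    pos (toℕ (lower₁ i ne)) (replaceStar O (toℕ (fromℕ (suc k))) (em q))
      ≡⟨ cong₂ (λ a b → pos a (replaceStar O b (em q))) (toℕ-lower₁ i ne) (toℕ-fromℕ (suc k)) ⟩
    pos (toℕ i) (replaceStar O (suc k) (em q))               ≡⟨ pos-before O (suc k) (toℕ i) (em q) i<1+k ⟩
    pos (toℕ i) (em q)                                        ∎
    where
    open ≡-Reasoning
    i<1+k : toℕ i < suc k
    i<1+k with toℕ<n i
    ... | s≤s i≤1+k = ≤∧≢⇒< i≤1+k (ne ∘ sym)

  face-step : ∀ {m} α (i : Fin (suc m)) (q : Cell (suc m)) k →
              StepAt (dirVal α) (U (lam Q m i q)) k (at (em q) k) (at (em (face α i q)) k)
  face-step {m} α i q k =
    subst₂ (λ p v → StepAt (dirVal α) p k (at (em q) k) (at v k))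
           (sym (U-lam m i q)) (sym (faceOK α i q))
           (replaceStar-step (dirVal α) (toℕ i) (em q) (star-in-range i q) k)

  at-init : ∀ k → at (em init) k ≡ O
  at-init k = trans (cong (λ v → at v k) initOK) (at-replicate n k)

  labels-∪ : (A : Cell 1 → Set) (x : Cell 1) (k : ℕ) →
             (∃ λ y → (A y ⊎ _≈U_ Q y x) × U y ≡ k) ⇔ ((∃ λ y → A y × U y ≡ k) ⊎ U x ≡ k)
  labels-∪ A x k = mk⇔ to from
    where
    to : (∃ λ y → (A y ⊎ _≈U_ Q y x) × U y ≡ k) → (∃ λ y → A y × U y ≡ k) ⊎ U x ≡ k
    to (y , inj₁ a , e) = inj₁ (y , a , e)
    to (y , inj₂ r , e) = inj₂ (trans (sym (U-respects-≈ r)) e)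
    from : (∃ λ y → A y × U y ≡ k) ⊎ U x ≡ k → ∃ λ y → (A y ⊎ _≈U_ Q y x) × U y ≡ k
    from (inj₁ (y , a , e)) = y , inj₁ a , e
    from (inj₂ e)           = x , inj₂ ε , e

  S-labels : ∀ {m q} (π : Path Q m q) k → (∃ λ y → Sπ Q π y × U y ≡ k) ⇔ (at (em q) k ≢ O)
  S-labels start k = mk⇔ (λ ()) (λ ne → ⊥-elim (ne (at-init k)))
  S-labels (up {m} π i q refl) k =
    ⇔-trans (labels-∪ (Sπ Q π) (lam Q m i q) k)
      (⇔-trans (S-labels π k ⊎-⇔ ⇔-id _)
               (lowering-support (face-step src i q k)))
  S-labels (down {m} {q} π i) k =
    ⇔-trans (S-labels π k) (raising-support (face-step tgt i q k))

  T-labels : ∀ {m q} (π : Path Q m q) k → (∃ λ y → Tπ Q π y × U y ≡ k) ⇔ (at (em q) k ≡ I)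
  T-labels start k = mk⇔ (λ ()) (λ e → case trans (sym (at-init k)) e of λ ())
  T-labels (up {m} π i q refl) k =
    ⇔-trans (T-labels π k) (lowering-top (face-step src i q k))
  T-labels (down {m} {q} π i) k =
    ⇔-trans (labels-∪ (Tπ Q π) (lam Q m i q) k)
      (⇔-trans (T-labels π k ⊎-⇔ ⇔-id _)
               (raising-top (face-step tgt i q k)))

  unlabelled-is-zero : ∀ {m q} k → (∀ e → U e ≢ k) → Path Q m q → at (em q) k ≡ O
  unlabelled-is-zero {q = q} k unlabelled π = decidable-stable (isO? (at (em q) k)) λ ne →
    let (y , _ , Uy≡k) = Equivalence.from (S-labels π k) ne in unlabelled y Uy≡k

  label-in-range : ∀ e → Σ (Fin n) λ i → toℕ i ≡ U e
  label-in-range e = at-in-range (em e) (U e) λ e≡O → case trans (sym star) e≡O of λ ()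
    where
    star : at (em e) (U e) ≡ S
    star = subst (λ k → at (em e) k ≡ S) (sym (starIndex≡pos0 (em e)))
                 (step-hit (replaceStar-step O 0 (em e) one-star (pos 0 (em e))))
      where
      one-star : 0 < countStar (em e)
      one-star = subst (0 <_) (sym (dimOK e)) (s≤s z≤n)

module Sculpture {Q : HDA} {n : ℕ} (E : Embedding Q n)
                 (simplistic : Simplistic E) (connected : Connected Q) where
  open HDA Q
  open Embedding E
  open Labelling E

  -- Q is finite, so whether some edge carries a given label is decidable.
  labelled? : ∀ k → Dec (∃ λ e → U e ≡ k)
  labelled? k = map′ (λ (j , p) → from j , p)
                     (λ (e , p) → to e , trans (cong U (strictlyInverseʳ e)) p)
                     (any? λ j → U (from j) ≟ k)
    where open Inverse (enum 1)

  -- Every coordinate is the label of an edge: an unlabelled coordinate would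
  -- be 0 on all of Q (which is connected), contradicting simplisticity.
  coordinate-label : (c : Fin n) → ∃ λ e → U e ≡ toℕ c
  coordinate-label c with labelled? (toℕ c)
  ... | yes labelled = labelled
  ... | no unlabelled = ⊥-elim (simplistic-uses-every-coordinate E simplistic c λ {m} q →
          trans (sym (at-lookup (em q) c))
                (unlabelled-is-zero (toℕ c) (λ e Ue≡c → unlabelled (e , Ue≡c)) (connected m q)))

  edge : Fin n → Cell 1
  edge c = proj₁ (coordinate-label c)

  U-edge : ∀ c → U (edge c) ≡ toℕ c
  U-edge c = proj₂ (coordinate-label c)

  image-of-support : ∀ {m} (P : Tri → Set) → (∀ {x} → P x → x ≢ O) →
                     {Sp : Pred (Fin n)} (q : Cell m) → Sp ≐ (λ i → P (lookup (em q) i)) →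
                     ∀ k → (∃ λ i → Sp i × U (edge i) ≡ k) ⇔ P (at (em q) k)
  image-of-support P P⇒≢O q Sp≐ k =
    ⇔-trans (mk⇔ (λ (i , s , e) → i , Equivalence.to   (Sp≐ i) s , trans (sym (U-edge i)) e)
                 (λ (i , p , e) → i , Equivalence.from (Sp≐ i) p , trans (U-edge i) e))
            (fin-support P P⇒≢O (em q) k)

  edge-iso : IsIso (STem E) (H/≡em E) edge
  edge-iso = record
    { wellDef    = λ { refl → refl }
    ; injective  = λ e → toℕ-injective (trans (sym (U-edge _)) (trans e (U-edge _)))
    ; surjective = λ y → let (i , i≡Uy) = label-in-range y in i , trans (U-edge i) i≡Uy
    ; preserves  = preserves
    }
    where
    -- The configuration of a cell q is sent to that of a rooted path to q.
    preserves : ∀ Sp Tp → STStructure.Conf (STem E) Sp Tp →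
                STStructure.Conf (H/≡em E) (image (STem E) (H/≡em E) edge Sp)
                                           (image (STem E) (H/≡em E) edge Tp)
    preserves Sp Tp (lift (m , q , Sp≐ , Tp≐)) =
      Sπ Q π , Tπ Q π , lift (m , q , π , (λ _ → ⇔-id _) , (λ _ → ⇔-id _)) ,
      (λ x → ⇔-trans (image-of-support (_≢ O) id q Sp≐ (U x)) (⇔-sym (S-labels π (U x)))) ,
      (λ x → ⇔-trans (image-of-support (_≡ I) (λ { refl () }) q Tp≐ (U x)) (⇔-sym (T-labels π (U x))))
      where
      π : Path Q m q
      π = connected m q

proposition4p17 : (Q : HDA) (n : ℕ) (em : Embedding Q n) →
    Simplistic em → Connected Q → STem em ≅ H/≡em em
proposition4p17 Q n em simplistic connected = edge , edge-iso
  where open Sculpture em simplistic connected
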